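{- Let $H=(V,\mathcal F)$ be a hypergraph and $k$ a nonnegative integer. Then $H$ has a $k$-mini-hitting set if and only if there exists a tuple $(a_1,\dots,a_p)$ of integers such that (a) $p\le k$, $a_i\ge 1$ for all $i\in[p]$, and $\sum_{i=1}^p a_i=p+k$; and (b) $B_H^*$ has a subgraph isomorphic to a bush of dimension $(a_1,\dots,a_p)$.
   Context: A hypergraph $H=(V,\mathcal F)$ has a finite vertex set $V$ and a family $\mathcal F$ of nonempty subsets of $V$ (edges; parallel edges allowed). For $S\subseteq V$, $\mathcal F[S]$ is the family of edges containing at least one vertex of $S$ (counted with multiplicity). A $k$-mini-hitting set is a set $S\subseteq V$ with $|S|\le k$ and $|\mathcal F[S]|\ge |S|+k$. The incidence bipartite graph $B_H$ has partite sets $V$ and $\mathcal F$, with $v$ adjacent to $e$ iff $v\in e$. $B_H^*$ is obtained from $B_H$ by adding a triangle on three new vertices $x,y,z$ and making $y$ adjacent to every vertex of $V$. A star of size $\ell$ is $K_{1,\ell}$; its central vertex is a vertex of degree $\ell$ (both vertices of $K_{1,1}$ are central). A star-forest of dimension $(a_1,\dots,a_p)$ is a disjoint union of $p$ stars of sizes $a_1,\dots,a_p$. A bush of dimension $(a_1,\dots,a_p)$ is obtained from a star-forest of dimension $(a_1,\dots,a_p)$ by adding a triangle $x,y,z$ and making $y$ adjacent to a central vertex of every star. Subgraphs need not be induced. -}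

module Defs where

open import Data.Nat using (ℕ; _+_; _≤_)
open import Data.Fin using (Fin)
open import Data.Fin.Subset using (Subset; _∩_; ∣_∣; Nonempty; _∈_)
open import Data.Fin.Subset.Properties using (nonempty?)
open import Data.Vec using (Vec; lookup; count; sum)
open import Data.Sum using (_⊎_)
open import Data.Product using (Σ; _×_)
open import Relation.Binary.PropositionalEquality using (_≡_)

-- A hypergraph with vertex set Fin n and m edges (indexed, so parallel
-- edges are allowed); each edge is a nonempty subset of the vertices.
record Hypergraph : Set where
  field
    n        : ℕ
    m        : ℕ
    edges    : Vec (Subset n) m
    nonempty : ∀ (j : Fin m) → Nonempty (lookup edges j)
open Hypergraph public

hitCount : (H : Hypergraph) → Subset (n H) → ℕ
hitCount H S = count (λ e → nonempty? (e ∩ S)) (edges H)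

IsMiniHitting : (H : Hypergraph) → ℕ → Subset (n H) → Set
IsMiniHitting H k S = (∣ S ∣ ≤ k) × (∣ S ∣ + k ≤ hitCount H S)

HasMiniHitting : Hypergraph → ℕ → Set
HasMiniHitting H k = Σ (Subset (n H)) (IsMiniHitting H k)

data BV (H : Hypergraph) : Set where
  vtx : Fin (n H) → BV H
  edg : Fin (m H) → BV H
  X Y Z : BV H

-- one orientation of each edge of B_H^*
data BArc (H : Hypergraph) : BV H → BV H → Set where
  inc : ∀ (v : Fin (n H)) (e : Fin (m H)) → v ∈ lookup (edges H) e →
        BArc H (vtx v) (edg e)
  xy  : BArc H X Y
  yz  : BArc H Y Z
  xz  : BArc H X Z
  yv  : ∀ (v : Fin (n H)) → BArc H Y (vtx v)

BAdj : (H : Hypergraph) → BV H → BV H → Set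
BAdj H u v = BArc H u v ⊎ BArc H v u

data BushV {p : ℕ} (a : Vec ℕ p) : Set where
  centre : Fin p → BushV a
  leaf   : (i : Fin p) → Fin (lookup a i) → BushV a
  bx by bz : BushV a

data BushE {p : ℕ} (a : Vec ℕ p) : BushV a → BushV a → Set where
  star : ∀ (i : Fin p) (j : Fin (lookup a i)) → BushE a (centre i) (leaf i j)
  exy  : BushE a bx by
  eyz  : BushE a by bz
  exz  : BushE a bx bz
  ey   : ∀ (i : Fin p) → BushE a by (centre i)

-- B_H^* has a (not necessarily induced) subgraph isomorphic to the bush:
-- an injective vertex map sending edges to edges.
HasBushSubgraph : (H : Hypergraph) → {p : ℕ} → Vec ℕ p → Set
HasBushSubgraph H a =
  Σ (BushV a → BV H) λ f →
    (∀ u v → f u ≡ f v → u ≡ v) ×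
    (∀ u v → BushE a u v → BAdj H (f u) (f v))

-- Both sides are equivalent to a family of vertex-disjoint stars in the incidence graph B_H,
-- centred at vertices, with edges of H as leaves. A bush in B_H^* is such a family together with
-- the triangle: XYZ is the only triangle of B_H^* and Y its only vertex with neighbours off it,
-- so the star centres land in V and the leaves in F. The set of centres of p such stars with
-- p + k leaves is a k-mini-hitting set when p ≤ k. Conversely, enumerate a k-mini-hitting set
-- S as v₁, …, v_s and let Dᵢ be the edges through vᵢ avoiding v₁, …, vᵢ₋₁; the Dᵢ partition
-- F[S], so Σ |Dᵢ| ≥ s + k. Taking the nonempty Dᵢ as stars until their excess Σ (|Dᵢ| − 1)
-- reaches k, and truncating the last one, gives p ≤ s stars with p + k leaves.

module Submission where

open import Defs
open import Data.Bool using () renaming (_≟_ to _≟ᵇ_)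
open import Data.Nat using (ℕ; zero; suc; _+_; _∸_; _≤_; z≤n; s≤s; _≤?_)
open import Data.Nat.Properties
  using (≤-refl; ≤-trans; ≤-reflexive; n≤1+n; m≤n⇒m≤1+n; +-mono-≤; +-monoˡ-≤; +-monoʳ-≤;
         +-suc; +-comm; +-assoc; +-identityʳ; +-cancelʳ-≤; m∸n+n≡m; n≤0⇒n≡0; ≰⇒>;
         module ≤-Reasoning)
open import Data.Fin using (Fin; zero; suc; splitAt; _↑ˡ_; _↑ʳ_; inject≤)
open import Data.Fin.Properties
  using (any?; injective⇒≤; suc-injective; splitAt⁻¹-↑ˡ; splitAt⁻¹-↑ʳ; inject≤-injective)
  renaming (_≟_ to _≟ᶠ_)
open import Data.Fin.Subset using (Subset; _∈_; _∩_; ∣_∣; Nonempty; inside)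
open import Data.Fin.Subset.Properties using (nonempty?; _∈?_; x∈p∩q⁺; x∈p∩q⁻)
open import Data.Vec using (Vec; []; _∷_; lookup; count; sum; tabulate)
open import Data.Vec.Properties using (lookup∘tabulate; []=⇒lookup; lookup⇒[]=)
open import Data.List using (List; []; _∷_; length)
import Data.List as List
open import Data.List.Properties using (length-tabulate)
open import Data.List.Relation.Unary.Any using (Any; here; there)
import Data.List.Relation.Unary.Any as Any
open import Data.List.Membership.Propositional using (lose) renaming (_∈_ to _∈ₗ_)
open import Data.List.Membership.Propositional.Properties using (∈-tabulate⁺)
open import Data.Product using (Σ; ∃; _×_; _,_; proj₁; proj₂; uncurry)
open import Data.Sum using (_⊎_; inj₁; inj₂; swap; [_,_]′)
open import Data.Empty using (⊥; ⊥-elim)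
open import Function using (_∘_)
open import Function.Bundles using (_⇔_; mk⇔)
open import Function.Definitions using (Injective)
open import Relation.Nullary using (¬_; yes; no; does)
open import Relation.Nullary.Decidable using (_×-dec_; ¬?; dec-true)
open import Relation.Unary using (Pred; Decidable; _⊆_; _∪_)
open import Relation.Binary.PropositionalEquality
  using (_≡_; _≢_; refl; sym; trans; cong; subst; ≢-sym; module ≡-Reasoning)

module _ {a p} {A : Set a} {P : Pred A p} (P? : Decidable P) where

  count-≤-∷ : ∀ {m} x (xs : Vec A m) → count P? xs ≤ count P? (x ∷ xs)
  count-≤-∷ x xs with P? x
  ... | yes _ = n≤1+n _
  ... | no _  = ≤-refl

  count-∅ : ∀ {m} (xs : Vec A m) → (∀ x → ¬ P x) → count P? xs ≡ 0
  count-∅ []       ¬P = refl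
  count-∅ (x ∷ xs) ¬P with P? x
  ... | yes px = ⊥-elim (¬P x px)
  ... | no _   = count-∅ xs ¬P

  -- c is always count P? xs; as a parameter it lets enumerate split on P? x.
  record Enumeration {m} (xs : Vec A m) (c : ℕ) : Set p where
    field
      index          : Fin c → Fin m
      index-injective : Injective _≡_ _≡_ index
      index-sound    : ∀ t → P (lookup xs (index t))
      index-complete : ∀ j → P (lookup xs j) → ∃ λ t → index t ≡ j

  enumerate : ∀ {m} (xs : Vec A m) → Enumeration xs (count P? xs)
  enumerate [] = record
    { index = λ () ; index-injective = λ {} ; index-sound = λ () ; index-complete = λ () }
  enumerate (x ∷ xs) with P? x
  ... | yes px = record
    { index = index′ ; index-injective = index′-injective
    ; index-sound = index′-sound ; index-complete = index′-complete }
    where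
    open Enumeration (enumerate xs)
    index′ : Fin (suc (count P? xs)) → Fin (suc _)
    index′ zero    = zero
    index′ (suc t) = suc (index t)
    index′-injective : Injective _≡_ _≡_ index′
    index′-injective {zero}  {zero}  _  = refl
    index′-injective {suc s} {suc t} eq = cong suc (index-injective (suc-injective eq))
    index′-sound : ∀ t → P (lookup (x ∷ xs) (index′ t))
    index′-sound zero    = px
    index′-sound (suc t) = index-sound t
    index′-complete : ∀ j → P (lookup (x ∷ xs) j) → ∃ λ t → index′ t ≡ j
    index′-complete zero    _  = zero , refl
    index′-complete (suc j) pj with index-complete j pj
    ... | t , eq = suc t , cong suc eq
  ... | no ¬px = record
    { index = λ t → suc (index t) ; index-injective = λ eq → index-injective (suc-injective eq)
    ; index-sound = index-sound ; index-complete = index′-complete }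
    where
    open Enumeration (enumerate xs)
    index′-complete : ∀ j → P (lookup (x ∷ xs) j) → ∃ λ t → suc (index t) ≡ j
    index′-complete zero    px = ⊥-elim (¬px px)
    index′-complete (suc j) pj with index-complete j pj
    ... | t , eq = t , cong suc eq

  injective⇒≤count : ∀ {ℓ m} (xs : Vec A m) (g : Fin ℓ → Fin m) → Injective _≡_ _≡_ g →
                     (∀ t → P (lookup xs (g t))) → ℓ ≤ count P? xs
  injective⇒≤count xs g g-injective g-sound = injective⇒≤ h-injective
    where
    open Enumeration (enumerate xs)
    h : Fin _ → Fin (count P? xs)
    h t = proj₁ (index-complete (g t) (g-sound t))
    index∘h : ∀ t → index (h t) ≡ g t
    index∘h t = proj₂ (index-complete (g t) (g-sound t))
    h-injective : Injective _≡_ _≡_ h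
    h-injective {s} {t} eq = g-injective (begin
      g s         ≡⟨ sym (index∘h s) ⟩
      index (h s) ≡⟨ cong index eq ⟩
      index (h t) ≡⟨ index∘h t ⟩
      g t         ∎)
      where open ≡-Reasoning

module _ {a p q} {A : Set a} {P : Pred A p} {Q : Pred A q}
         (P? : Decidable P) (Q? : Decidable Q) where

  count-mono : ∀ {m} (xs : Vec A m) → P ⊆ Q → count P? xs ≤ count Q? xs
  count-mono []       P⊆Q = z≤n
  count-mono (x ∷ xs) P⊆Q with P? x
  ... | no _ = ≤-trans (count-mono xs P⊆Q) (count-≤-∷ Q? x xs)
  ... | yes px with Q? x
  ...   | yes _ = s≤s (count-mono xs P⊆Q)
  ...   | no ¬qx = ⊥-elim (¬qx (P⊆Q px))

  count-≤-+ : ∀ {r} {R : Pred A r} (R? : Decidable R) {m} (xs : Vec A m) → P ⊆ Q ∪ R →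
              count P? xs ≤ count Q? xs + count R? xs
  count-≤-+ R? []       P⊆Q∪R = z≤n
  count-≤-+ R? (x ∷ xs) P⊆Q∪R with P? x
  ... | no _ =
    ≤-trans (count-≤-+ R? xs P⊆Q∪R) (+-mono-≤ (count-≤-∷ Q? x xs) (count-≤-∷ R? x xs))
  ... | yes px with Q? x | R? x | P⊆Q∪R px
  ...   | yes _  | yes _  | _       =
    s≤s (≤-trans (count-≤-+ R? xs P⊆Q∪R) (+-monoʳ-≤ (count Q? xs) (n≤1+n _)))
  ...   | yes _  | no _   | _       = s≤s (count-≤-+ R? xs P⊆Q∪R)
  ...   | no _   | yes _  | _       =
    ≤-trans (s≤s (count-≤-+ R? xs P⊆Q∪R)) (≤-reflexive (sym (+-suc _ _)))
  ...   | no ¬qx | no _   | inj₁ qx = ⊥-elim (¬qx qx)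
  ...   | no _   | no ¬rx | inj₂ rx = ⊥-elim (¬rx rx)

Leaf : ∀ {p} → Vec ℕ p → Set
Leaf {p} a = Σ (Fin p) λ i → Fin (lookup a i)

leafPosition : ∀ {p} (a : Vec ℕ p) → Leaf a → Fin (sum a)
leafPosition (s ∷ a) (zero  , j) = j ↑ˡ sum a
leafPosition (s ∷ a) (suc i , j) = s ↑ʳ leafPosition a (i , j)

leafAt : ∀ {p} (a : Vec ℕ p) → Fin (sum a) → Leaf a
leafAt (s ∷ a) t with splitAt s t
... | inj₁ j  = zero , j
... | inj₂ t′ = suc (proj₁ (leafAt a t′)) , proj₂ (leafAt a t′)

leafPosition∘leafAt : ∀ {p} (a : Vec ℕ p) t → leafPosition a (leafAt a t) ≡ t
leafPosition∘leafAt (s ∷ a) t with splitAt s t in eq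
... | inj₁ j  = splitAt⁻¹-↑ˡ eq
... | inj₂ t′ = trans (cong (s ↑ʳ_) (leafPosition∘leafAt a t′)) (splitAt⁻¹-↑ʳ eq)

leafAt-injective : ∀ {p} (a : Vec ℕ p) → Injective _≡_ _≡_ (leafAt a)
leafAt-injective a {s} {t} eq = begin
  s                             ≡⟨ sym (leafPosition∘leafAt a s) ⟩
  leafPosition a (leafAt a s)   ≡⟨ cong (leafPosition a) eq ⟩
  leafPosition a (leafAt a t)   ≡⟨ leafPosition∘leafAt a t ⟩
  t                             ∎
  where open ≡-Reasoning

image : ∀ {p n} → (Fin p → Fin n) → Subset n
image f = tabulate λ v → does (any? λ i → f i ≟ᶠ v)

∈-image⁺ : ∀ {p n} (f : Fin p → Fin n) i → f i ∈ image f
∈-image⁺ f i = lookup⇒[]= (f i) (image f)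
  (trans (lookup∘tabulate _ (f i)) (dec-true (any? λ i′ → f i′ ≟ᶠ f i) (i , refl)))

∈-image⁻ : ∀ {p n} (f : Fin p → Fin n) {v} → v ∈ image f → ∃ λ i → f i ≡ v
∈-image⁻ f {v} v∈
  with any? (λ i → f i ≟ᶠ v) | trans (sym (lookup∘tabulate _ v)) ([]=⇒lookup v∈)
... | yes found | _  = found
... | no _      | ()

∣image∣≤ : ∀ {p n} (f : Fin p → Fin n) → ∣ image f ∣ ≤ p
∣image∣≤ f = injective⇒≤ preimage-injective
  where
  open Enumeration (enumerate (_≟ᵇ inside) (image f))
  preimage : Fin ∣ image f ∣ → Fin _
  preimage t = proj₁ (∈-image⁻ f (lookup⇒[]= _ _ (index-sound t)))
  preimage-injective : Injective _≡_ _≡_ preimage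
  preimage-injective {s} {t} eq = index-injective (begin
    index s            ≡⟨ sym (proj₂ (∈-image⁻ f (lookup⇒[]= _ _ (index-sound s)))) ⟩
    f (preimage s)     ≡⟨ cong f eq ⟩
    f (preimage t)     ≡⟨ proj₂ (∈-image⁻ f (lookup⇒[]= _ _ (index-sound t))) ⟩
    index t            ∎)
    where open ≡-Reasoning

elements : ∀ {n} → Subset n → List (Fin n)
elements S = List.tabulate (Enumeration.index (enumerate (_≟ᵇ inside) S))

length-elements : ∀ {n} (S : Subset n) → length (elements S) ≡ ∣ S ∣
length-elements S = length-tabulate _

∈-elements : ∀ {n} {S : Subset n} {v} → v ∈ S → v ∈ₗ elements S
∈-elements {S = S} v∈S with index-complete _ ([]=⇒lookup v∈S)
  where open Enumeration (enumerate (_≟ᵇ inside) S)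
... | t , refl = ∈-tabulate⁺ t

pigeonhole₂ : ∀ {a} {A : Set a} {x y u₁ u₂ u₃ : A} →
              u₁ ≡ x ⊎ u₁ ≡ y → u₂ ≡ x ⊎ u₂ ≡ y → u₃ ≡ x ⊎ u₃ ≡ y →
              u₁ ≢ u₂ → u₁ ≢ u₃ → u₂ ≢ u₃ → ⊥
pigeonhole₂ (inj₁ refl) (inj₁ refl) _           u₁≢u₂ _     _     = u₁≢u₂ refl
pigeonhole₂ (inj₂ refl) (inj₂ refl) _           u₁≢u₂ _     _     = u₁≢u₂ refl
pigeonhole₂ (inj₁ refl) (inj₂ refl) (inj₁ refl) _     u₁≢u₃ _     = u₁≢u₃ refl
pigeonhole₂ (inj₁ refl) (inj₂ refl) (inj₂ refl) _     _     u₂≢u₃ = u₂≢u₃ refl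
pigeonhole₂ (inj₂ refl) (inj₁ refl) (inj₁ refl) _     _     u₂≢u₃ = u₂≢u₃ refl
pigeonhole₂ (inj₂ refl) (inj₁ refl) (inj₂ refl) _     u₁≢u₃ _     = u₁≢u₃ refl

module _ {H : Hypergraph} where

  vtx-injective : ∀ {u v} → vtx {H} u ≡ vtx v → u ≡ v
  vtx-injective refl = refl

  edg-injective : ∀ {e e′} → edg {H} e ≡ edg e′ → e ≡ e′
  edg-injective refl = refl

  BArc-irrefl : ∀ {u} → ¬ BArc H u u
  BArc-irrefl ()

  BAdj-irrefl : ∀ {u w} → BAdj H u w → u ≢ w
  BAdj-irrefl (inj₁ u→w) refl = BArc-irrefl u→w
  BAdj-irrefl (inj₂ w→u) refl = BArc-irrefl w→u

  neighbour-vtx : ∀ {v u} → BAdj H (vtx v) u →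
                  (∃ λ e → u ≡ edg e × v ∈ lookup (edges H) e) ⊎ u ≡ Y
  neighbour-vtx (inj₁ (inc _ e v∈e)) = inj₁ (e , refl , v∈e)
  neighbour-vtx (inj₂ (yv _))        = inj₂ refl

  neighbour-edg : ∀ {e u} → BAdj H (edg e) u → ∃ λ v → u ≡ vtx v
  neighbour-edg (inj₂ (inc v _ _)) = v , refl

  neighbour-X : ∀ {u} → BAdj H X u → u ≡ Y ⊎ u ≡ Z
  neighbour-X (inj₁ xy) = inj₁ refl
  neighbour-X (inj₁ xz) = inj₂ refl

  neighbour-Z : ∀ {u} → BAdj H Z u → u ≡ X ⊎ u ≡ Y
  neighbour-Z (inj₂ xz) = inj₁ refl
  neighbour-Z (inj₂ yz) = inj₂ refl

  neighbour-Y : ∀ {u} → BAdj H Y u → (u ≡ X ⊎ u ≡ Z) ⊎ ∃ λ v → u ≡ vtx v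
  neighbour-Y (inj₂ xy)     = inj₁ (inj₁ refl)
  neighbour-Y (inj₁ yz)     = inj₁ (inj₂ refl)
  neighbour-Y (inj₁ (yv v)) = inj₂ (v , refl)

  Corner : BV H → Set
  Corner b = b ≡ X ⊎ b ≡ Y ⊎ b ≡ Z

  triangle-corner : ∀ {x b z} → BAdj H x b → BAdj H b z → BAdj H x z → Corner b
  triangle-corner {b = vtx v} x~b b~z x~z with neighbour-vtx (swap x~b) | neighbour-vtx b~z
  ... | inj₁ (_ , refl , _) | inj₁ (_ , refl , _) = ⊥-elim ([ (λ ()) , (λ ()) ]′ x~z)
  ... | inj₁ (_ , refl , _) | inj₂ refl           = ⊥-elim ([ (λ ()) , (λ ()) ]′ x~z)
  ... | inj₂ refl           | inj₁ (_ , refl , _) = ⊥-elim ([ (λ ()) , (λ ()) ]′ x~z)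
  ... | inj₂ refl           | inj₂ refl           = ⊥-elim (BAdj-irrefl x~z refl)
  triangle-corner {b = edg e} x~b b~z x~z with neighbour-edg (swap x~b) | neighbour-edg b~z
  ... | _ , refl | _ , refl = ⊥-elim ([ (λ ()) , (λ ()) ]′ x~z)
  triangle-corner {b = X} _ _ _ = inj₁ refl
  triangle-corner {b = Y} _ _ _ = inj₂ (inj₁ refl)
  triangle-corner {b = Z} _ _ _ = inj₂ (inj₂ refl)

  corner-≢Y : ∀ {u} → Corner u → u ≢ Y → u ≡ X ⊎ u ≡ Z
  corner-≢Y (inj₁ u≡X)        _   = inj₁ u≡X
  corner-≢Y (inj₂ (inj₁ u≡Y)) u≢Y = ⊥-elim (u≢Y u≡Y)
  corner-≢Y (inj₂ (inj₂ u≡Z)) _   = inj₂ u≡Z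

  Y-triangle-corner : ∀ {x z} → BAdj H x Y → BAdj H Y z → BAdj H x z → x ≡ X ⊎ x ≡ Z
  Y-triangle-corner x~Y Y~z x~z =
    corner-≢Y (triangle-corner (swap x~z) x~Y (swap Y~z)) (BAdj-irrefl x~Y)

  -- XYZ is the only triangle of B_H^*, and Y is the only one of its vertices with a neighbour
  -- off the triangle: X and Z have degree 2.
  triangle-exit : ∀ {x b z c} → BAdj H x b → BAdj H b z → BAdj H x z → BAdj H b c →
                  c ≢ x → c ≢ z → b ≡ Y × ∃ λ v → c ≡ vtx v
  triangle-exit x~b b~z x~z b~c c≢x c≢z with triangle-corner x~b b~z x~z
  ... | inj₁ refl =
    ⊥-elim (pigeonhole₂ (neighbour-X (swap x~b)) (neighbour-X b~z) (neighbour-X b~c)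
                        (BAdj-irrefl x~z) (≢-sym c≢x) (≢-sym c≢z))
  ... | inj₂ (inj₂ refl) =
    ⊥-elim (pigeonhole₂ (neighbour-Z (swap x~b)) (neighbour-Z b~z) (neighbour-Z b~c)
                        (BAdj-irrefl x~z) (≢-sym c≢x) (≢-sym c≢z))
  ... | inj₂ (inj₁ refl) with neighbour-Y b~c
  ...   | inj₂ (v , c≡v) = refl , v , c≡v
  ...   | inj₁ c∈XZ      =
    ⊥-elim (pigeonhole₂ (Y-triangle-corner x~b b~z x~z)
                        (Y-triangle-corner (swap b~z) (swap x~b) (swap x~z)) c∈XZ
                        (BAdj-irrefl x~z) (≢-sym c≢x) (≢-sym c≢z))

module _ (H : Hypergraph) where

  private
    Vertex = Fin (n H)
    Edge   = Fin (m H)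

  _∈ᴱ_ : Vertex → Edge → Set
  v ∈ᴱ e = v ∈ lookup (edges H) e

  record StarFamily {p} (a : Vec ℕ p) : Set where
    field
      centreVertex           : Fin p → Vertex
      leafEdge               : Leaf a → Edge
      centreVertex-injective : Injective _≡_ _≡_ centreVertex
      leafEdge-injective     : Injective _≡_ _≡_ leafEdge
      centre∈leafEdge        : ∀ i j → centreVertex i ∈ᴱ leafEdge (i , j)

  stars⇒bush : ∀ {p} {a : Vec ℕ p} → StarFamily a → HasBushSubgraph H a
  stars⇒bush {a = a} F = f , f-injective , f-homomorphic
    where
    open StarFamily F
    f : BushV a → BV H
    f (centre i) = vtx (centreVertex i)
    f (leaf i j) = edg (leafEdge (i , j))
    f bx = X
    f by = Y
    f bz = Z
    f-injective : ∀ u v → f u ≡ f v → u ≡ v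
    f-injective (centre i) (centre i′) eq = cong centre (centreVertex-injective (vtx-injective eq))
    f-injective (leaf i j) (leaf i′ j′) eq = cong (uncurry leaf) (leafEdge-injective (edg-injective eq))
    f-injective bx         bx           _    = refl
    f-injective by         by           _    = refl
    f-injective bz         bz           _    = refl
    f-injective (centre _) (leaf _ _)   ()
    f-injective (centre _) bx           ()
    f-injective (centre _) by           ()
    f-injective (centre _) bz           ()
    f-injective (leaf _ _) (centre _)   ()
    f-injective (leaf _ _) bx           ()
    f-injective (leaf _ _) by           ()
    f-injective (leaf _ _) bz           ()
    f-injective bx         (centre _)   ()
    f-injective bx         (leaf _ _)   ()
    f-injective bx         by           ()
    f-injective bx         bz           ()
    f-injective by         (centre _)   ()
    f-injective by         (leaf _ _)   ()
    f-injective by         bx           ()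
    f-injective by         bz           ()
    f-injective bz         (centre _)   ()
    f-injective bz         (leaf _ _)   ()
    f-injective bz         bx           ()
    f-injective bz         by           ()
    f-homomorphic : ∀ u v → BushE a u v → BAdj H (f u) (f v)
    f-homomorphic _ _ (star i j) = inj₁ (inc _ _ (centre∈leafEdge i j))
    f-homomorphic _ _ exy        = inj₁ xy
    f-homomorphic _ _ eyz        = inj₁ yz
    f-homomorphic _ _ exz        = inj₁ xz
    f-homomorphic _ _ (ey i)     = inj₁ (yv _)

  bush⇒stars : ∀ {p} {a : Vec ℕ p} → HasBushSubgraph H a → StarFamily a
  bush⇒stars {a = a} (f , f-injective , f-homomorphic) = record
    { centreVertex           = centreVertex
    ; leafEdge               = leafEdge
    ; centreVertex-injective = λ {i} {i′} eq →
        centre-injective (f-reflects (trans (centre↦vtx i) (cong vtx eq)) (centre↦vtx i′))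
    ; leafEdge-injective     = λ {(i , j)} {(i′ , j′)} eq →
        leaf-injective (f-reflects (trans (leaf↦edg i j) (cong edg eq)) (leaf↦edg i′ j′))
    ; centre∈leafEdge        = λ i j → proj₂ (proj₂ (leafEdgeOf i j))
    }
    where
    centre-injective : ∀ {i i′} → centre {a = a} i ≡ centre i′ → i ≡ i′
    centre-injective refl = refl
    leaf-injective : ∀ {i i′ j j′} → leaf {a = a} i j ≡ leaf i′ j′ → (i , j) ≡ (i′ , j′)
    leaf-injective refl = refl
    f-reflects : ∀ {u v w} → f u ≡ w → f v ≡ w → u ≡ v
    f-reflects fu≡w fv≡w = f-injective _ _ (trans fu≡w (sym fv≡w))
    f≢ : ∀ {u v} → u ≢ v → f u ≢ f v
    f≢ u≢v = u≢v ∘ f-injective _ _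
    exit : ∀ i → f by ≡ Y × ∃ λ v → f (centre i) ≡ vtx v
    exit i = triangle-exit (f-homomorphic _ _ exy) (f-homomorphic _ _ eyz) (f-homomorphic _ _ exz)
                           (f-homomorphic _ _ (ey i)) (f≢ λ ()) (f≢ λ ())
    centreVertex : Fin _ → Vertex
    centreVertex i = proj₁ (proj₂ (exit i))
    centre↦vtx : ∀ i → f (centre i) ≡ vtx (centreVertex i)
    centre↦vtx i = proj₂ (proj₂ (exit i))
    leafEdgeOf : ∀ i j → ∃ λ e → f (leaf i j) ≡ edg e × centreVertex i ∈ᴱ e
    leafEdgeOf i j with neighbour-vtx (subst (λ u → BAdj H u (f (leaf i j))) (centre↦vtx i)
                                             (f-homomorphic _ _ (star i j)))
    ... | inj₁ found  = found
    ... | inj₂ leaf↦Y = ⊥-elim (f≢ (λ ()) (trans leaf↦Y (sym (proj₁ (exit i)))))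
    leafEdge : Leaf a → Edge
    leafEdge (i , j) = proj₁ (leafEdgeOf i j)
    leaf↦edg : ∀ i j → f (leaf i j) ≡ edg (leafEdge (i , j))
    leaf↦edg i j = proj₁ (proj₂ (leafEdgeOf i j))

  sum≤hitCount : ∀ {p} {a : Vec ℕ p} (F : StarFamily a) →
                 sum a ≤ hitCount H (image (StarFamily.centreVertex F))
  sum≤hitCount {a = a} F = injective⇒≤count (λ e → nonempty? (e ∩ S)) (edges H)
    (leafEdge ∘ leafAt a) (leafAt-injective a ∘ leafEdge-injective) hits-S
    where
    open StarFamily F
    S = image centreVertex
    hits-S : ∀ t → Nonempty (lookup (edges H) (leafEdge (leafAt a t)) ∩ S)
    hits-S t = let (i , j) = leafAt a t in
      centreVertex i , x∈p∩q⁺ (centre∈leafEdge i j , ∈-image⁺ centreVertex i)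

  bush⇒miniHitting : ∀ {p k} {a : Vec ℕ p} → p ≤ k → sum a ≡ p + k → HasBushSubgraph H a →
                     HasMiniHitting H k
  bush⇒miniHitting {p} {k} {a} p≤k sum≡ bush = S , ≤-trans ∣S∣≤p p≤k , (begin
    ∣ S ∣ + k     ≤⟨ +-monoˡ-≤ k ∣S∣≤p ⟩
    p + k         ≡⟨ sym sum≡ ⟩
    sum a         ≤⟨ sum≤hitCount F ⟩
    hitCount H S  ∎)
    where
    open ≤-Reasoning
    F = bush⇒stars bush
    S = image (StarFamily.centreVertex F)
    ∣S∣≤p : ∣ S ∣ ≤ p
    ∣S∣≤p = ∣image∣≤ (StarFamily.centreVertex F)

  addStar : ∀ {p s} {a : Vec ℕ p} (F : StarFamily a) (v : Vertex) (g : Fin (suc s) → Edge) →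
            Injective _≡_ _≡_ g → (∀ j → v ∈ᴱ g j) →
            (∀ i j → ¬ StarFamily.centreVertex F i ∈ᴱ g j) → StarFamily (suc s ∷ a)
  addStar {s = s} {a} F v g g-injective v∈g fresh = record
    { centreVertex           = centreVertex′
    ; leafEdge               = leafEdge′
    ; centreVertex-injective = centreVertex′-injective
    ; leafEdge-injective     = leafEdge′-injective
    ; centre∈leafEdge        = centre∈leafEdge′
    }
    where
    open StarFamily F
    centreVertex′ : Fin _ → Vertex
    centreVertex′ zero    = v
    centreVertex′ (suc i) = centreVertex i
    leafEdge′ : Leaf (suc s ∷ a) → Edge
    leafEdge′ (zero  , j) = g j
    leafEdge′ (suc i , j) = leafEdge (i , j)
    sucLeaf : Leaf a → Leaf (suc s ∷ a)
    sucLeaf (i , j) = suc i , j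
    centreVertex′-injective : Injective _≡_ _≡_ centreVertex′
    centreVertex′-injective {zero}  {zero}   _  = refl
    centreVertex′-injective {zero}  {suc i}  eq =
      ⊥-elim (fresh i zero (subst (_∈ᴱ g zero) eq (v∈g zero)))
    centreVertex′-injective {suc i} {zero}   eq =
      ⊥-elim (fresh i zero (subst (_∈ᴱ g zero) (sym eq) (v∈g zero)))
    centreVertex′-injective {suc i} {suc i′} eq = cong suc (centreVertex-injective eq)
    leafEdge′-injective : Injective _≡_ _≡_ leafEdge′
    leafEdge′-injective {zero  , j} {zero   , j′} eq = cong (zero ,_) (g-injective eq)
    leafEdge′-injective {zero  , j} {suc i′ , j′} eq =
      ⊥-elim (fresh i′ j (subst (centreVertex i′ ∈ᴱ_) (sym eq) (centre∈leafEdge i′ j′)))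
    leafEdge′-injective {suc i , j} {zero   , j′} eq =
      ⊥-elim (fresh i j′ (subst (centreVertex i ∈ᴱ_) eq (centre∈leafEdge i j)))
    leafEdge′-injective {suc i , j} {suc i′ , j′} eq = cong sucLeaf (leafEdge-injective eq)
    centre∈leafEdge′ : ∀ i j → centreVertex′ i ∈ᴱ leafEdge′ (i , j)
    centre∈leafEdge′ zero    j = v∈g j
    centre∈leafEdge′ (suc i) j = centre∈leafEdge i j

  Meets : List Vertex → Subset (n H) → Set
  Meets L s = Any (_∈ s) L

  meets? : ∀ L → Decidable (Meets L)
  meets? L s = Any.any? (_∈? s) L

  hits : List Vertex → ℕ
  hits L = count (meets? L) (edges H)

  New : Vertex → List Vertex → Subset (n H) → Set
  New v L s = v ∈ s × ¬ Meets L s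

  new? : ∀ v L → Decidable (New v L)
  new? v L s = (v ∈? s) ×-dec ¬? (meets? L s)

  hits-∷ : ∀ v L → hits (v ∷ L) ≤ hits L + count (new? v L) (edges H)
  hits-∷ v L = count-≤-+ (meets? (v ∷ L)) (meets? L) (new? v L) (edges H) split
    where
    split : Meets (v ∷ L) ⊆ Meets L ∪ New v L
    split (there meets) = inj₁ meets
    split {s} (here v∈s) with meets? L s
    ... | yes meets = inj₁ meets
    ... | no ¬meets = inj₂ (v∈s , ¬meets)

  record Packing (L : List Vertex) (r : ℕ) : Set where
    field
      p              : ℕ
      sizes          : Vec ℕ p
      sizes-positive : ∀ i → 1 ≤ lookup sizes i
      sum-sizes      : sum sizes ≡ p + r
      p≤length       : p ≤ length L
      stars          : StarFamily sizes
      centres∈L      : ∀ i → StarFamily.centreVertex stars i ∈ₗ L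

  emptyPacking : ∀ L → Packing L 0
  emptyPacking L = record
    { p = 0 ; sizes = [] ; sizes-positive = λ () ; sum-sizes = refl ; p≤length = z≤n
    ; stars = record { centreVertex = λ () ; leafEdge = λ () ; centreVertex-injective = λ {}
                     ; leafEdge-injective = λ {} ; centre∈leafEdge = λ () }
    ; centres∈L = λ () }

  weakenPacking : ∀ {L r} v → Packing L r → Packing (v ∷ L) r
  weakenPacking v P = record
    { p = p ; sizes = sizes ; sizes-positive = sizes-positive ; sum-sizes = sum-sizes
    ; p≤length = m≤n⇒m≤1+n p≤length ; stars = stars ; centres∈L = there ∘ centres∈L }
    where open Packing P

  addStarPacking : ∀ {L r s v} (P : Packing L r) (g : Fin (suc s) → Edge) → Injective _≡_ _≡_ g →
                   (∀ j → New v L (lookup (edges H) (g j))) → Packing (v ∷ L) (r + s)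
  addStarPacking {L} {r} {s} {v} P g g-injective g-new = record
    { p              = suc p
    ; sizes          = suc s ∷ sizes
    ; sizes-positive = λ { zero → s≤s z≤n ; (suc i) → sizes-positive i }
    ; sum-sizes      = cong suc (begin
        s + sum sizes   ≡⟨ cong (s +_) sum-sizes ⟩
        s + (p + r)     ≡⟨ +-comm s (p + r) ⟩
        p + r + s       ≡⟨ +-assoc p r s ⟩
        p + (r + s)     ∎)
    ; p≤length       = s≤s p≤length
    ; stars          = addStar stars v g g-injective (proj₁ ∘ g-new) fresh
    ; centres∈L      = λ { zero → here refl ; (suc i) → there (centres∈L i) }
    }
    where
    open Packing P
    open ≡-Reasoning
    fresh : ∀ i j → ¬ StarFamily.centreVertex stars i ∈ᴱ g j
    fresh i j c∈g = proj₂ (g-new j) (lose (centres∈L i) c∈g)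

  packStars : ∀ L r → length L + r ≤ hits L → Packing L r
  packStars []      r h = subst (Packing []) (sym r≡0) (emptyPacking [])
    where
    r≡0 : r ≡ 0
    r≡0 = n≤0⇒n≡0 (≤-trans h (≤-reflexive (count-∅ (meets? []) (edges H) (λ _ ()))))
  packStars (v ∷ L) r h
    with count (new? v L) (edges H) | enumerate (new? v L) (edges H) | hits-∷ v L
  ... | zero  | _ | hits≤ = weakenPacking v (packStars L r (begin
    length L + r        ≤⟨ n≤1+n _ ⟩
    suc (length L + r)  ≤⟨ h ⟩
    hits (v ∷ L)        ≤⟨ hits≤ ⟩
    hits L + 0          ≡⟨ +-identityʳ _ ⟩
    hits L              ∎))
    where open ≤-Reasoning
  ... | suc d | E | hits≤ with d ≤? r
  ...   | yes d≤r = subst (Packing (v ∷ L)) (m∸n+n≡m d≤r)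
                      (addStarPacking (packStars L (r ∸ d) bound) index index-injective index-sound)
    where
    open Enumeration E
    bound : length L + (r ∸ d) ≤ hits L
    bound = +-cancelʳ-≤ (suc d) _ _ (begin
      length L + (r ∸ d) + suc d    ≡⟨ +-assoc (length L) (r ∸ d) (suc d) ⟩
      length L + (r ∸ d + suc d)    ≡⟨ cong (length L +_) (+-suc (r ∸ d) d) ⟩
      length L + suc (r ∸ d + d)    ≡⟨ cong (λ x → length L + suc x) (m∸n+n≡m d≤r) ⟩
      length L + suc r              ≡⟨ +-suc (length L) r ⟩
      suc (length L + r)            ≤⟨ h ⟩
      hits (v ∷ L)                  ≤⟨ hits≤ ⟩
      hits L + suc d                ∎)
      where open ≤-Reasoning
  -- more than r + 1 new edges: a single star of size r + 1 at v suffices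
  ...   | no d≰r = addStarPacking (emptyPacking L) (index ∘ truncate)
                     (inject≤-injective _ _ _ _ ∘ index-injective) (index-sound ∘ truncate)
    where
    open Enumeration E
    truncate : Fin (suc r) → Fin (suc d)
    truncate t = inject≤ t (m≤n⇒m≤1+n (≰⇒> d≰r))

  hitCount⇒packing : ∀ {k} (S : Subset (n H)) → ∣ S ∣ + k ≤ hitCount H S → Packing (elements S) k
  hitCount⇒packing {k} S hit = packStars (elements S) k (begin
    length (elements S) + k  ≡⟨ cong (_+ k) (length-elements S) ⟩
    ∣ S ∣ + k                ≤⟨ hit ⟩
    hitCount H S             ≤⟨ count-mono (λ e → nonempty? (e ∩ S)) (meets? (elements S))
                                           (edges H) meets ⟩
    hits (elements S)        ∎)
    where
    open ≤-Reasoning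
    meets : ∀ {s} → Nonempty (s ∩ S) → Meets (elements S) s
    meets {s} (v , v∈s∩S) =
      let (v∈s , v∈S) = x∈p∩q⁻ s S v∈s∩S in lose (∈-elements v∈S) v∈s

lemma15 : (H : Hypergraph) (k : ℕ) →
    HasMiniHitting H k ⇔
    Σ ℕ (λ p → Σ (Vec ℕ p) (λ a →
      ((p ≤ k) × (∀ (i : Fin p) → 1 ≤ lookup a i) × (sum a ≡ p + k)) ×
      HasBushSubgraph H a))
lemma15 H k = mk⇔
  (λ (S , ∣S∣≤k , hit) → let open Packing (hitCount⇒packing H S hit) in
     p , sizes ,
     ( ≤-trans p≤length (≤-trans (≤-reflexive (length-elements S)) ∣S∣≤k)
     , sizes-positive , sum-sizes ) ,
     stars⇒bush H stars)
  (λ (_ , _ , (p≤k , _ , sum≡) , bush) → bush⇒miniHitting H p≤k sum≡ bush)
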